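{- For every $n\in\mathbb{N}$, \[ \sum_{k=1}^{n}\frac{(-1)^{k-1}}{k}\binom{n}{k}H_{n-k}=H_n^2+\sum_{k=1}^{n}\frac{(-1)^{k}}{k^2\binom{n}{k}}. \]
   Context: $H_m=\sum_{j=1}^{m}\frac1j$ denotes the $m$-th harmonic number, with $H_0=0$. -}

module Defs where

open import Data.Nat using (ℕ; zero; suc) renaming (_*_ to _*ℕ_; _∸_ to _∸ℕ_)
open import Data.Nat.Combinatorics using (_C_)
open import Data.Integer using (+_)
open import Data.Rational using (ℚ; 0ℚ; 1ℚ; _+_; _*_; -_; _/_)

-- reciprocal of a natural number as a rational; recip 0 = 0 is a junk value
-- that is never used in the statement (all denominators there are positive)
recip : ℕ → ℚ
recip zero = 0ℚ
recip (suc m) = (+ 1) / suc m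

sgn : ℕ → ℚ
sgn zero = 1ℚ
sgn (suc m) = - sgn m

Σ₁ : ℕ → (ℕ → ℚ) → ℚ
Σ₁ zero f = 0ℚ
Σ₁ (suc n) f = Σ₁ n f + f (suc n)

H : ℕ → ℚ
H m = Σ₁ m recip

lhs : ℕ → ℚ
lhs n = Σ₁ n (λ k → sgn (k ∸ℕ 1) * recip k * ((+ (n C k)) / 1) * H (n ∸ℕ k))

rhs : ℕ → ℚ
rhs n = H n * H n + Σ₁ n (λ k → sgn k * recip (k *ℕ k *ℕ (n C k)))

module Submission where

-- Both sides vanish at n = 0, and both grow by 2 (H_{n+1} - (-1)^n/(n+1)) / (n+1) from n to n + 1.
-- On the left, Pascal's rule together with H_{n+1-k} = H_{n-k} + 1/(n+1-k) and the absorption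
-- identity C(n,k-1)/k = C(n+1,k)/(n+1) reduce the increment to the classical sums
-- Σ (-1)^(k-1) C(m,k)/k = H_m and Σ (-1)^(k-1) C(m,k) H_{m-k} = H_m + (-1)^m/m.
-- On the right, 1/(k C(n+1,k)) = 1/(k C(n,k)) - 1/((n+1) C(n,k)), and the sum
-- Σ (-1)^k/(k C(n,k)) = ((-1)^n - 1)/(n+1) telescopes because
-- 1/(k C(n,k)) = 1/((n+1) C(n,k-1)) + 1/((n+1) C(n,k)).

open import Defs
open import Data.Nat as ℕ using (ℕ; zero; suc; NonZero)
open import Data.Nat.Combinatorics using (_C_; nCk+nC[k+1]≡[n+1]C[k+1]; nC1≡n; nCn≡1; k>n⇒nCk≡0)

module BinomialIdentities where
  open import Data.Nat using (_+_; _*_; _∸_; _≤_; _<_; z≤n; s≤s)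
  open import Data.Nat.Properties
  open import Relation.Binary.PropositionalEquality
  open ≡-Reasoning

  [k+1]*[n+1]C[k+1]≡[n+1]*nCk : ∀ n k → suc k * (suc n C suc k) ≡ suc n * (n C k)
  [k+1]*[n+1]C[k+1]≡[n+1]*nCk n zero = begin
    1 * (suc n C 1)  ≡⟨ *-identityˡ (suc n C 1) ⟩
    suc n C 1        ≡⟨ nC1≡n (suc n) ⟩
    suc n            ≡⟨ *-identityʳ (suc n) ⟨
    suc n * 1        ∎
  [k+1]*[n+1]C[k+1]≡[n+1]*nCk zero (suc k) = *-zeroʳ (suc (suc k))
  [k+1]*[n+1]C[k+1]≡[n+1]*nCk (suc n) (suc k) = begin
    suc (suc k) * (suc (suc n) C suc (suc k))   ≡⟨ cong (suc (suc k) *_) (nCk+nC[k+1]≡[n+1]C[k+1] (suc n) (suc k)) ⟨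
    suc (suc k) * (P + Q)                       ≡⟨ *-distribˡ-+ (suc (suc k)) P Q ⟩
    (P + suc k * P) + suc (suc k) * Q           ≡⟨ cong₂ (λ a b → (P + a) + b) ([k+1]*[n+1]C[k+1]≡[n+1]*nCk n k)
                                                                              ([k+1]*[n+1]C[k+1]≡[n+1]*nCk n (suc k)) ⟩
    (P + suc n * (n C k)) + suc n * (n C suc k) ≡⟨ +-assoc P (suc n * (n C k)) (suc n * (n C suc k)) ⟩
    P + (suc n * (n C k) + suc n * (n C suc k)) ≡⟨ cong (P +_) (*-distribˡ-+ (suc n) (n C k) (n C suc k)) ⟨
    P + suc n * (n C k + n C suc k)             ≡⟨ cong (λ a → P + suc n * a) (nCk+nC[k+1]≡[n+1]C[k+1] n k) ⟩
    suc (suc n) * P                             ∎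
    where
    P = suc n C suc k
    Q = suc n C suc (suc k)

  [n+1]*nCk+k*[n+1]Ck≡[n+1]*[n+1]Ck : ∀ n k → suc n * (n C k) + k * (suc n C k) ≡ suc n * (suc n C k)
  [n+1]*nCk+k*[n+1]Ck≡[n+1]*[n+1]Ck n zero    = +-identityʳ (suc n * 1)
  [n+1]*nCk+k*[n+1]Ck≡[n+1]*[n+1]Ck n (suc k) = begin
    suc n * (n C suc k) + suc k * (suc n C suc k) ≡⟨ cong (suc n * (n C suc k) +_) ([k+1]*[n+1]C[k+1]≡[n+1]*nCk n k) ⟩
    suc n * (n C suc k) + suc n * (n C k)         ≡⟨ +-comm (suc n * (n C suc k)) (suc n * (n C k)) ⟩
    suc n * (n C k) + suc n * (n C suc k)         ≡⟨ *-distribˡ-+ (suc n) (n C k) (n C suc k) ⟨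
    suc n * (n C k + n C suc k)                   ≡⟨ cong (suc n *_) (nCk+nC[k+1]≡[n+1]C[k+1] n k) ⟩
    suc n * (suc n C suc k)                       ∎

  [n+1]*nCk≡[n+1∸k]*[n+1]Ck : ∀ n k → suc n * (n C k) ≡ (suc n ∸ k) * (suc n C k)
  [n+1]*nCk≡[n+1∸k]*[n+1]Ck n k = begin
    suc n * (n C k)
      ≡⟨ m+n∸n≡m (suc n * (n C k)) (k * (suc n C k)) ⟨
    suc n * (n C k) + k * (suc n C k) ∸ k * (suc n C k)
      ≡⟨ cong (_∸ k * (suc n C k)) ([n+1]*nCk+k*[n+1]Ck≡[n+1]*[n+1]Ck n k) ⟩
    suc n * (suc n C k) ∸ k * (suc n C k)
      ≡⟨ *-distribʳ-∸ (suc n C k) (suc n) k ⟨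
    (suc n ∸ k) * (suc n C k)
      ∎

  nCk>0 : ∀ {n k} → k ≤ n → 0 < n C k
  nCk>0 {k = zero} _ = s≤s z≤n
  nCk>0 {suc n} {suc k} (s≤s k≤n) =
    subst (0 <_) (nCk+nC[k+1]≡[n+1]C[k+1] n k) (<-≤-trans (nCk>0 k≤n) (m≤m+n (n C k) (n C suc k)))

open BinomialIdentities

open import Data.Integer using (+_)
import Data.Integer as ℤ
import Data.Integer.Properties as ℤ
import Data.Nat.Properties as ℕ
import Data.Nat.Coprimality as Coprimality
open import Data.Nat.Tactic.RingSolver using (solve-∀)
open import Data.Rational using (ℚ; mkℚ; 0ℚ; 1ℚ; _+_; _*_; -_; _-_; _/_; 1/_; toℚᵘ)
open import Data.Rational.Properties
open import Data.Rational.Solver using (module +-*-Solver)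
open import Data.Rational.Unnormalised using (mkℚᵘ; *≡*)
import Data.Rational.Unnormalised as ℚᵘ
import Data.Rational.Unnormalised.Properties as ℚᵘ
open import Algebra.Bundles using (CommutativeMonoid)
open import Algebra.Properties.CommutativeSemigroup (CommutativeMonoid.commutativeSemigroup *-1-commutativeMonoid)
  using (interchange; x∙yz≈y∙xz; xy∙z≈xz∙y; xy∙z≈x∙zy)
open import Algebra.Properties.CommutativeSemigroup (CommutativeMonoid.commutativeSemigroup +-0-commutativeMonoid)
  using () renaming (interchange to +-interchange)
open import Function.Base using (it)
open import Relation.Binary.PropositionalEquality

-- Written as in lhs, so that binom below unfolds to the casts occurring there.
ι : ℕ → ℚ
ι n = + n / 1

toℚᵘ-ι : ∀ n → toℚᵘ (ι n) ≡ mkℚᵘ (+ n) 0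
toℚᵘ-ι n = cong toℚᵘ (normalize-coprime (Coprimality.sym (Coprimality.1-coprimeTo n)))

ι-+ : ∀ m n → ι (m ℕ.+ n) ≡ ι m + ι n
ι-+ m n = toℚᵘ-injective (begin
  toℚᵘ (ι (m ℕ.+ n))              ≡⟨ toℚᵘ-ι (m ℕ.+ n) ⟩
  mkℚᵘ (+ (m ℕ.+ n)) 0            ≈⟨ *≡* (cong (ℤ._* ℤ.1ℤ) numerators) ⟩
  mkℚᵘ (+ m) 0 ℚᵘ.+ mkℚᵘ (+ n) 0  ≡⟨ cong₂ ℚᵘ._+_ (toℚᵘ-ι m) (toℚᵘ-ι n) ⟨
  toℚᵘ (ι m) ℚᵘ.+ toℚᵘ (ι n)      ≈⟨ toℚᵘ-homo-+ (ι m) (ι n) ⟨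
  toℚᵘ (ι m + ι n)                ∎)
  where
  open ℚᵘ.≃-Reasoning
  numerators : + (m ℕ.+ n) ≡ + m ℤ.* ℤ.1ℤ ℤ.+ + n ℤ.* ℤ.1ℤ
  numerators = trans (ℤ.pos-+ m n) (sym (cong₂ ℤ._+_ (ℤ.*-identityʳ (+ m)) (ℤ.*-identityʳ (+ n))))

ι-* : ∀ m n → ι (m ℕ.* n) ≡ ι m * ι n
ι-* m n = toℚᵘ-injective (begin
  toℚᵘ (ι (m ℕ.* n))              ≡⟨ toℚᵘ-ι (m ℕ.* n) ⟩
  mkℚᵘ (+ (m ℕ.* n)) 0            ≈⟨ *≡* (cong (ℤ._* ℤ.1ℤ) (ℤ.pos-* m n)) ⟩
  mkℚᵘ (+ m) 0 ℚᵘ.* mkℚᵘ (+ n) 0  ≡⟨ cong₂ ℚᵘ._*_ (toℚᵘ-ι m) (toℚᵘ-ι n) ⟨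
  toℚᵘ (ι m) ℚᵘ.* toℚᵘ (ι n)      ≈⟨ toℚᵘ-homo-* (ι m) (ι n) ⟨
  toℚᵘ (ι m * ι n)                ∎)
  where open ℚᵘ.≃-Reasoning

open ≡-Reasoning

ι*recip≡1 : ∀ n .{{_ : NonZero n}} → ι n * recip n ≡ 1ℚ
ι*recip≡1 (suc n) = begin
  ι (suc n) * recip (suc n)  ≡⟨ cong₂ _*_ (normalize-coprime (Coprimality.sym coprime)) (normalize-coprime coprime) ⟩
  p * 1/ p                   ≡⟨ *-inverseʳ p ⟩
  1ℚ                         ∎
  where
  coprime = Coprimality.1-coprimeTo (suc n)
  p = mkℚ (+ suc n) 0 (Coprimality.sym coprime)

recip*[ι*p]≡p : ∀ n .{{_ : NonZero n}} p → recip n * (ι n * p) ≡ p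
recip*[ι*p]≡p n p = begin
  recip n * (ι n * p)   ≡⟨ *-assoc (recip n) (ι n) p ⟨
  recip n * ι n * p     ≡⟨ cong (_* p) (trans (*-comm (recip n) (ι n)) (ι*recip≡1 n)) ⟩
  1ℚ * p                ≡⟨ *-identityˡ p ⟩
  p                     ∎

recip-* : ∀ m n → recip (m ℕ.* n) ≡ recip m * recip n
recip-* zero    n       = sym (*-zeroˡ (recip n))
recip-* (suc m) zero    = trans (cong recip (ℕ.*-zeroʳ (suc m))) (sym (*-zeroʳ (recip (suc m))))
recip-* (suc m) (suc n) = begin
  recip (M ℕ.* N)                                       ≡⟨ *-identityʳ (recip (M ℕ.* N)) ⟨
  recip (M ℕ.* N) * 1ℚ                                  ≡⟨ cong (recip (M ℕ.* N) *_) ι[M*N]*[recipM*recipN]≡1 ⟨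
  recip (M ℕ.* N) * (ι (M ℕ.* N) * (recip M * recip N)) ≡⟨ recip*[ι*p]≡p (M ℕ.* N) (recip M * recip N) ⟩
  recip M * recip N                                     ∎
  where
  M = suc m
  N = suc n
  ι[M*N]*[recipM*recipN]≡1 : ι (M ℕ.* N) * (recip M * recip N) ≡ 1ℚ
  ι[M*N]*[recipM*recipN]≡1 = begin
    ι (M ℕ.* N) * (recip M * recip N) ≡⟨ cong (_* (recip M * recip N)) (ι-* M N) ⟩
    ι M * ι N * (recip M * recip N)   ≡⟨ interchange (ι M) (ι N) (recip M) (recip N) ⟩
    ι M * recip M * (ι N * recip N)   ≡⟨ cong₂ _*_ (ι*recip≡1 M) (ι*recip≡1 N) ⟩
    1ℚ                                ∎

recip*ι-cross : ∀ a b c d .{{_ : NonZero a}} .{{_ : NonZero b}} →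
                a ℕ.* d ≡ b ℕ.* c → recip b * ι d ≡ recip a * ι c
recip*ι-cross a b c d ad≡bc = begin
  recip b * ι d                     ≡⟨ recip*[ι*p]≡p a (recip b * ι d) ⟨
  recip a * (ι a * (recip b * ι d)) ≡⟨ cong (recip a *_) (x∙yz≈y∙xz (ι a) (recip b) (ι d)) ⟩
  recip a * (recip b * (ι a * ι d)) ≡⟨ cong (λ p → recip a * (recip b * p)) ι[a]*ι[d]≡ι[b]*ι[c] ⟩
  recip a * (recip b * (ι b * ι c)) ≡⟨ cong (recip a *_) (recip*[ι*p]≡p b (ι c)) ⟩
  recip a * ι c                     ∎
  where
  ι[a]*ι[d]≡ι[b]*ι[c] : ι a * ι d ≡ ι b * ι c
  ι[a]*ι[d]≡ι[b]*ι[c] = trans (sym (ι-* a d)) (trans (cong ι ad≡bc) (ι-* b c))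

recip+recip : ∀ m n .{{_ : NonZero m}} .{{_ : NonZero n}} →
              recip m + recip n ≡ ι (m ℕ.+ n) * recip (m ℕ.* n)
recip+recip m n = sym (begin
  ι (m ℕ.+ n) * recip (m ℕ.* n)
    ≡⟨ cong₂ _*_ (ι-+ m n) (recip-* m n) ⟩
  (ι m + ι n) * (recip m * recip n)
    ≡⟨ *-distribʳ-+ (recip m * recip n) (ι m) (ι n) ⟩
  ι m * (recip m * recip n) + ι n * (recip m * recip n)
    ≡⟨ cong₂ _+_ (*-assoc (ι m) (recip m) (recip n)) (x∙yz≈y∙xz (recip m) (ι n) (recip n)) ⟨
  ι m * recip m * recip n + recip m * (ι n * recip n)
    ≡⟨ cong₂ (λ u v → u * recip n + recip m * v) (ι*recip≡1 m) (ι*recip≡1 n) ⟩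
  1ℚ * recip n + recip m * 1ℚ
    ≡⟨ cong₂ _+_ (*-identityˡ (recip n)) (*-identityʳ (recip m)) ⟩
  recip n + recip m
    ≡⟨ +-comm (recip n) (recip m) ⟩
  recip m + recip n
    ∎)

recip+recip≡recip : ∀ x y z .{{_ : NonZero x}} .{{_ : NonZero y}} .{{_ : NonZero z}} →
                    z ℕ.* (x ℕ.+ y) ≡ x ℕ.* y → recip x + recip y ≡ recip z
recip+recip≡recip x y z z[x+y]≡xy = begin
  recip x + recip y             ≡⟨ recip+recip x y ⟩
  ι (x ℕ.+ y) * recip (x ℕ.* y) ≡⟨ *-comm (ι (x ℕ.+ y)) (recip (x ℕ.* y)) ⟩
  recip (x ℕ.* y) * ι (x ℕ.+ y) ≡⟨ recip*ι-cross z (x ℕ.* y) 1 (x ℕ.+ y) {{it}} {{ℕ.m*n≢0 x y}}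
                                     (trans z[x+y]≡xy (sym (ℕ.*-identityʳ (x ℕ.* y)))) ⟩
  recip z * ι 1                 ≡⟨ *-identityʳ (recip z) ⟩
  recip z                       ∎

Σ₁-cong : ∀ n {f g : ℕ → ℚ} → (∀ j → j ℕ.< n → f (suc j) ≡ g (suc j)) → Σ₁ n f ≡ Σ₁ n g
Σ₁-cong zero    f≗g = refl
Σ₁-cong (suc n) f≗g = cong₂ _+_ (Σ₁-cong n (λ j j<n → f≗g j (ℕ.m<n⇒m<1+n j<n))) (f≗g n (ℕ.n<1+n n))

Σ₁-+ : ∀ n (f g : ℕ → ℚ) → Σ₁ n (λ k → f k + g k) ≡ Σ₁ n f + Σ₁ n g
Σ₁-+ zero    f g = refl
Σ₁-+ (suc n) f g = trans (cong (_+ (f (suc n) + g (suc n))) (Σ₁-+ n f g))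
                         (+-interchange (Σ₁ n f) (Σ₁ n g) (f (suc n)) (g (suc n)))

*-distribˡ-Σ₁ : ∀ n a (f : ℕ → ℚ) → a * Σ₁ n f ≡ Σ₁ n (λ k → a * f k)
*-distribˡ-Σ₁ zero    a f = *-zeroʳ a
*-distribˡ-Σ₁ (suc n) a f = trans (*-distribˡ-+ a (Σ₁ n f) (f (suc n)))
                                  (cong (_+ a * f (suc n)) (*-distribˡ-Σ₁ n a f))

neg-distrib-Σ₁ : ∀ n (f : ℕ → ℚ) → - Σ₁ n f ≡ Σ₁ n (λ k → - f k)
neg-distrib-Σ₁ zero    f = refl
neg-distrib-Σ₁ (suc n) f = trans (neg-distrib-+ (Σ₁ n f) (f (suc n)))
                                 (cong (_+ - f (suc n)) (neg-distrib-Σ₁ n f))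

Σ₁-suc : ∀ n (f : ℕ → ℚ) → Σ₁ (suc n) f ≡ f 1 + Σ₁ n (λ k → f (suc k))
Σ₁-suc zero    f = +-comm 0ℚ (f 1)
Σ₁-suc (suc n) f = trans (cong (_+ f (suc (suc n))) (Σ₁-suc n f))
                         (+-assoc (f 1) (Σ₁ n (λ k → f (suc k))) (f (suc (suc n))))

Σ₁-without-last : ∀ n (f : ℕ → ℚ) → Σ₁ n f ≡ Σ₁ (suc n) f - f (suc n)
Σ₁-without-last n f = solve 2 (λ s x → s := s :+ x :- x) refl (Σ₁ n f) (f (suc n))
  where open +-*-Solver

Σ₁-alternating-telescope : ∀ n (z : ℕ → ℚ) →
                           Σ₁ n (λ k → sgn k * (z (ℕ.pred k) + z k)) ≡ sgn n * z n - z 0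
Σ₁-alternating-telescope zero    z = sym (trans (cong (_- z 0) (*-identityˡ (z 0))) (+-inverseʳ (z 0)))
Σ₁-alternating-telescope (suc n) z = begin
  Σ₁ n (λ k → sgn k * (z (ℕ.pred k) + z k)) + - sgn n * (z n + z (suc n))
    ≡⟨ cong (_+ - sgn n * (z n + z (suc n))) (Σ₁-alternating-telescope n z) ⟩
  sgn n * z n - z 0 + - sgn n * (z n + z (suc n))
    ≡⟨ solve 4 (λ s a b c → s :* a :- c :+ (:- s) :* (a :+ b) := (:- s) :* b :- c) refl
               (sgn n) (z n) (z (suc n)) (z 0) ⟩
  - sgn n * z (suc n) - z 0
    ∎
  where open +-*-Solver

binom : ℕ → ℕ → ℚ
binom n k = ι (n C k)

binom-diag : ∀ n → binom n n ≡ 1ℚ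
binom-diag n = cong ι (nCn≡1 n)

binom-pascal : ∀ n k → binom (suc n) (suc k) ≡ binom n (suc k) + binom n k
binom-pascal n k = begin
  ι (suc n C suc k)           ≡⟨ cong ι (nCk+nC[k+1]≡[n+1]C[k+1] n k) ⟨
  ι (n C k ℕ.+ n C suc k)     ≡⟨ ι-+ (n C k) (n C suc k) ⟩
  binom n k + binom n (suc k) ≡⟨ +-comm (binom n k) (binom n (suc k)) ⟩
  binom n (suc k) + binom n k ∎

recip[k+1]*nCk≡recip[n+1]*[n+1]C[k+1] : ∀ n k →
  recip (suc k) * binom n k ≡ recip (suc n) * binom (suc n) (suc k)
recip[k+1]*nCk≡recip[n+1]*[n+1]C[k+1] n k =
  recip*ι-cross (suc n) (suc k) (suc n C suc k) (n C k) (sym ([k+1]*[n+1]C[k+1]≡[n+1]*nCk n k))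

recip[n+1-k]*nCk≡recip[n+1]*[n+1]Ck : ∀ {n k} → k ℕ.≤ n →
  recip (suc (n ℕ.∸ k)) * binom n k ≡ recip (suc n) * binom (suc n) k
recip[n+1-k]*nCk≡recip[n+1]*[n+1]Ck {n} {k} k≤n =
  recip*ι-cross (suc n) (suc (n ℕ.∸ k)) (suc n C k) (n C k)
    (trans ([n+1]*nCk≡[n+1∸k]*[n+1]Ck n k) (cong (ℕ._* (suc n C k)) (ℕ.+-∸-assoc 1 k≤n)))

Σ₁-pascal : ∀ n (f : ℕ → ℚ) →
  Σ₁ (suc n) (λ k → f k * binom (suc n) k)
  ≡ Σ₁ n (λ k → f k * binom n k) + Σ₁ (suc n) (λ k → f k * binom n (ℕ.pred k))
Σ₁-pascal n f = begin
  Σ₁ (suc n) (λ k → f k * binom (suc n) k)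
    ≡⟨ Σ₁-cong (suc n) (λ j _ → trans (cong (f (suc j) *_) (binom-pascal n j))
                                      (*-distribˡ-+ (f (suc j)) (binom n (suc j)) (binom n j))) ⟩
  Σ₁ (suc n) (λ k → f k * binom n k + f k * binom n (ℕ.pred k))
    ≡⟨ Σ₁-+ (suc n) (λ k → f k * binom n k) (λ k → f k * binom n (ℕ.pred k)) ⟩
  A + f (suc n) * binom n (suc n) + P
    ≡⟨ cong (λ t → A + t + P) top≡0 ⟩
  A + 0ℚ + P
    ≡⟨ cong (_+ P) (+-identityʳ A) ⟩
  A + P
    ∎
  where
  A = Σ₁ n (λ k → f k * binom n k)
  P = Σ₁ (suc n) (λ k → f k * binom n (ℕ.pred k))
  top≡0 : f (suc n) * binom n (suc n) ≡ 0ℚ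
  top≡0 = trans (cong (λ c → f (suc n) * ι c) (k>n⇒nCk≡0 (ℕ.n<1+n n))) (*-zeroʳ (f (suc n)))

Σ₁-binomial-init : ∀ n (f : ℕ → ℚ) →
  Σ₁ n (λ k → f k * binom (suc n) k) ≡ Σ₁ (suc n) (λ k → f k * binom (suc n) k) - f (suc n)
Σ₁-binomial-init n f = begin
  Σ₁ n g                                           ≡⟨ Σ₁-without-last n g ⟩
  Σ₁ (suc n) g - f (suc n) * binom (suc n) (suc n) ≡⟨ cong (λ b → Σ₁ (suc n) g - f (suc n) * b) (binom-diag (suc n)) ⟩
  Σ₁ (suc n) g - f (suc n) * 1ℚ                    ≡⟨ cong (_-_ (Σ₁ (suc n) g)) (*-identityʳ (f (suc n))) ⟩
  Σ₁ (suc n) g - f (suc n)                         ∎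
  where
  g = λ k → f k * binom (suc n) k

Σ₁-alternating-binomial : ∀ n → Σ₁ (suc n) (λ k → sgn (k ℕ.∸ 1) * binom (suc n) k) ≡ 1ℚ
Σ₁-alternating-binomial n = begin
  Σ₁ (suc n) (λ k → sgn (k ℕ.∸ 1) * binom (suc n) k)
    ≡⟨ Σ₁-pascal n (λ k → sgn (k ℕ.∸ 1)) ⟩
  X + Σ₁ (suc n) (λ k → sgn (k ℕ.∸ 1) * binom n (ℕ.pred k))
    ≡⟨ cong (_+_ X) (Σ₁-suc n (λ k → sgn (k ℕ.∸ 1) * binom n (ℕ.pred k))) ⟩
  X + (1ℚ * 1ℚ + Σ₁ n (λ k → sgn k * binom n k))
    ≡⟨ cong (λ s → X + (1ℚ * 1ℚ + s)) shifted≡-X ⟩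
  X + (1ℚ * 1ℚ + - X)
    ≡⟨ solve 1 (λ x → x :+ (con 1ℚ :* con 1ℚ :- x) := con 1ℚ) refl X ⟩
  1ℚ
    ∎
  where
  open +-*-Solver
  X = Σ₁ n (λ k → sgn (k ℕ.∸ 1) * binom n k)
  shifted≡-X : Σ₁ n (λ k → sgn k * binom n k) ≡ - X
  shifted≡-X = trans (Σ₁-cong n (λ j _ → sym (neg-distribˡ-* (sgn j) (binom n (suc j)))))
                     (sym (neg-distrib-Σ₁ n (λ k → sgn (k ℕ.∸ 1) * binom n k)))

Σ₁-harmonic-binomial : ∀ n → Σ₁ n (λ k → sgn (k ℕ.∸ 1) * recip k * binom n k) ≡ H n
Σ₁-harmonic-binomial zero    = refl
Σ₁-harmonic-binomial (suc n) = begin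
  Σ₁ (suc n) (λ k → sgn (k ℕ.∸ 1) * recip k * binom (suc n) k)
    ≡⟨ Σ₁-pascal n (λ k → sgn (k ℕ.∸ 1) * recip k) ⟩
  Σ₁ n (λ k → sgn (k ℕ.∸ 1) * recip k * binom n k)
    + Σ₁ (suc n) (λ k → sgn (k ℕ.∸ 1) * recip k * binom n (ℕ.pred k))
    ≡⟨ cong₂ _+_ (Σ₁-harmonic-binomial n) (Σ₁-cong (suc n) (λ j _ → absorb j)) ⟩
  H n + Σ₁ (suc n) (λ k → recip (suc n) * (sgn (k ℕ.∸ 1) * binom (suc n) k))
    ≡⟨ cong (_+_ (H n)) (*-distribˡ-Σ₁ (suc n) (recip (suc n)) (λ k → sgn (k ℕ.∸ 1) * binom (suc n) k)) ⟨
  H n + recip (suc n) * Σ₁ (suc n) (λ k → sgn (k ℕ.∸ 1) * binom (suc n) k)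
    ≡⟨ cong (λ s → H n + recip (suc n) * s) (Σ₁-alternating-binomial n) ⟩
  H n + recip (suc n) * 1ℚ
    ≡⟨ cong (_+_ (H n)) (*-identityʳ (recip (suc n))) ⟩
  H (suc n)
    ∎
  where
  absorb : ∀ j → sgn j * recip (suc j) * binom n j ≡ recip (suc n) * (sgn j * binom (suc n) (suc j))
  absorb j = begin
    sgn j * recip (suc j) * binom n j               ≡⟨ *-assoc (sgn j) (recip (suc j)) (binom n j) ⟩
    sgn j * (recip (suc j) * binom n j)             ≡⟨ cong (sgn j *_) (recip[k+1]*nCk≡recip[n+1]*[n+1]C[k+1] n j) ⟩
    sgn j * (recip (suc n) * binom (suc n) (suc j)) ≡⟨ x∙yz≈y∙xz (sgn j) (recip (suc n)) (binom (suc n) (suc j)) ⟩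
    recip (suc n) * (sgn j * binom (suc n) (suc j)) ∎

Σ₁-harmonic-pascal : ∀ n (w : ℕ → ℚ) →
  Σ₁ (suc n) (λ k → w k * H (suc n ℕ.∸ k) * binom (suc n) k)
  ≡ Σ₁ n (λ k → w k * H (n ℕ.∸ k) * binom n k)
    + recip (suc n) * Σ₁ n (λ k → w k * binom (suc n) k)
    + Σ₁ (suc n) (λ k → w k * H (suc n ℕ.∸ k) * binom n (ℕ.pred k))
Σ₁-harmonic-pascal n w =
  trans (Σ₁-pascal n (λ k → w k * H (suc n ℕ.∸ k)))
        (cong (_+ Σ₁ (suc n) (λ k → w k * H (suc n ℕ.∸ k) * binom n (ℕ.pred k))) lower)
  where
  R = recip (suc n)
  split : ∀ j → j ℕ.< n →
          w (suc j) * H (n ℕ.∸ j) * binom n (suc j)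
          ≡ w (suc j) * H (n ℕ.∸ suc j) * binom n (suc j) + R * (w (suc j) * binom (suc n) (suc j))
  split j j<n = begin
    a * H (n ℕ.∸ j) * b                  ≡⟨ cong (λ m → a * H m * b) (ℕ.+-∸-assoc 1 j<n) ⟩
    a * (h + r) * b                      ≡⟨ solve 4 (λ a h r b → a :* (h :+ r) :* b := a :* h :* b :+ a :* (r :* b))
                                                    refl a h r b ⟩
    a * h * b + a * (r * b)              ≡⟨ cong (λ t → a * h * b + a * t) (recip[n+1-k]*nCk≡recip[n+1]*[n+1]Ck j<n) ⟩
    a * h * b + a * (R * B)              ≡⟨ cong (_+_ (a * h * b)) (x∙yz≈y∙xz a R B) ⟩
    a * h * b + R * (a * B)              ∎
    where
    open +-*-Solver
    a = w (suc j)
    b = binom n (suc j)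
    B = binom (suc n) (suc j)
    h = H (n ℕ.∸ suc j)
    r = recip (suc (n ℕ.∸ suc j))
  lower : Σ₁ n (λ k → w k * H (suc n ℕ.∸ k) * binom n k)
          ≡ Σ₁ n (λ k → w k * H (n ℕ.∸ k) * binom n k) + R * Σ₁ n (λ k → w k * binom (suc n) k)
  lower = begin
    Σ₁ n (λ k → w k * H (suc n ℕ.∸ k) * binom n k)
      ≡⟨ Σ₁-cong n split ⟩
    Σ₁ n (λ k → w k * H (n ℕ.∸ k) * binom n k + R * (w k * binom (suc n) k))
      ≡⟨ Σ₁-+ n (λ k → w k * H (n ℕ.∸ k) * binom n k) (λ k → R * (w k * binom (suc n) k)) ⟩
    Σ₁ n (λ k → w k * H (n ℕ.∸ k) * binom n k) + Σ₁ n (λ k → R * (w k * binom (suc n) k))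
      ≡⟨ cong (_+_ (Σ₁ n (λ k → w k * H (n ℕ.∸ k) * binom n k)))
              (*-distribˡ-Σ₁ n R (λ k → w k * binom (suc n) k)) ⟨
    Σ₁ n (λ k → w k * H (n ℕ.∸ k) * binom n k) + R * Σ₁ n (λ k → w k * binom (suc n) k)
      ∎

Σ₁-harmonic-tail-binomial : ∀ n →
  Σ₁ (suc n) (λ k → sgn (k ℕ.∸ 1) * H (suc n ℕ.∸ k) * binom (suc n) k) ≡ H (suc n) - sgn n * recip (suc n)
Σ₁-harmonic-tail-binomial n = begin
  Σ₁ (suc n) (λ k → s k * H (suc n ℕ.∸ k) * binom (suc n) k)
    ≡⟨ Σ₁-harmonic-pascal n s ⟩
  T + recip (suc n) * Σ₁ n (λ k → s k * binom (suc n) k)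
    + Σ₁ (suc n) (λ k → s k * H (suc n ℕ.∸ k) * binom n (ℕ.pred k))
    ≡⟨ cong₂ (λ a p → T + recip (suc n) * a + p) alternating shifted ⟩
  T + recip (suc n) * (1ℚ - sgn n) + (1ℚ * H n * 1ℚ + - T)
    ≡⟨ solve 4 (λ t r s h → t :+ r :* (con 1ℚ :- s) :+ (con 1ℚ :* h :* con 1ℚ :+ :- t) := h :+ r :- s :* r)
               refl T (recip (suc n)) (sgn n) (H n) ⟩
  H (suc n) - sgn n * recip (suc n)
    ∎
  where
  open +-*-Solver
  s = λ k → sgn (k ℕ.∸ 1)
  T = Σ₁ n (λ k → s k * H (n ℕ.∸ k) * binom n k)
  alternating : Σ₁ n (λ k → s k * binom (suc n) k) ≡ 1ℚ - sgn n
  alternating = trans (Σ₁-binomial-init n s) (cong (_- sgn n) (Σ₁-alternating-binomial n))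
  negate : ∀ j → sgn (suc j) * H (n ℕ.∸ suc j) * binom n (suc j) ≡ - (sgn j * H (n ℕ.∸ suc j) * binom n (suc j))
  negate j = sym (trans (neg-distribˡ-* (sgn j * H (n ℕ.∸ suc j)) (binom n (suc j)))
                        (cong (_* binom n (suc j)) (neg-distribˡ-* (sgn j) (H (n ℕ.∸ suc j)))))
  shifted : Σ₁ (suc n) (λ k → s k * H (suc n ℕ.∸ k) * binom n (ℕ.pred k)) ≡ 1ℚ * H n * 1ℚ + - T
  shifted = trans (Σ₁-suc n (λ k → s k * H (suc n ℕ.∸ k) * binom n (ℕ.pred k)))
                  (cong (_+_ (1ℚ * H n * 1ℚ))
                        (trans (Σ₁-cong n (λ j _ → negate j))
                               (sym (neg-distrib-Σ₁ n (λ k → s k * H (n ℕ.∸ k) * binom n k)))))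

increment : ℕ → ℚ
increment n = recip (suc n) * (H (suc n) - sgn n * recip (suc n))

lhs-suc : ∀ n → lhs (suc n) ≡ lhs n + increment n + increment n
lhs-suc n = begin
  lhs (suc n)
    ≡⟨ reorder (suc n) ⟩
  Σ₁ (suc n) (λ k → w k * H (suc n ℕ.∸ k) * binom (suc n) k)
    ≡⟨ Σ₁-harmonic-pascal n w ⟩
  Σ₁ n (λ k → w k * H (n ℕ.∸ k) * binom n k) + recip (suc n) * Σ₁ n (λ k → w k * binom (suc n) k)
    + Σ₁ (suc n) (λ k → w k * H (suc n ℕ.∸ k) * binom n (ℕ.pred k))
    ≡⟨ cong₂ _+_ (cong₂ (λ a b → a + recip (suc n) * b) (sym (reorder n)) harmonic) absorbed ⟩
  lhs n + increment n + increment n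
    ∎
  where
  w = λ k → sgn (k ℕ.∸ 1) * recip k
  reorder : ∀ m → lhs m ≡ Σ₁ m (λ k → w k * H (m ℕ.∸ k) * binom m k)
  reorder m = Σ₁-cong m (λ j _ → xy∙z≈xz∙y (w (suc j)) (binom m (suc j)) (H (m ℕ.∸ suc j)))
  harmonic : Σ₁ n (λ k → w k * binom (suc n) k) ≡ H (suc n) - sgn n * recip (suc n)
  harmonic = trans (Σ₁-binomial-init n w) (cong (_- w (suc n)) (Σ₁-harmonic-binomial (suc n)))
  absorb : ∀ j → w (suc j) * H (n ℕ.∸ j) * binom n j
                 ≡ recip (suc n) * (sgn j * H (n ℕ.∸ j) * binom (suc n) (suc j))
  absorb j = begin
    sgn j * r * h * binom n j               ≡⟨ cong (_* binom n j) (xy∙z≈xz∙y (sgn j) r h) ⟩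
    sgn j * h * r * binom n j               ≡⟨ *-assoc (sgn j * h) r (binom n j) ⟩
    sgn j * h * (r * binom n j)             ≡⟨ cong (sgn j * h *_) (recip[k+1]*nCk≡recip[n+1]*[n+1]C[k+1] n j) ⟩
    sgn j * h * (recip (suc n) * B)         ≡⟨ x∙yz≈y∙xz (sgn j * h) (recip (suc n)) B ⟩
    recip (suc n) * (sgn j * h * B)         ∎
    where
    r = recip (suc j)
    h = H (n ℕ.∸ j)
    B = binom (suc n) (suc j)
  absorbed : Σ₁ (suc n) (λ k → w k * H (suc n ℕ.∸ k) * binom n (ℕ.pred k)) ≡ increment n
  absorbed = begin
    Σ₁ (suc n) (λ k → w k * H (suc n ℕ.∸ k) * binom n (ℕ.pred k))
      ≡⟨ Σ₁-cong (suc n) (λ j _ → absorb j) ⟩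
    Σ₁ (suc n) (λ k → recip (suc n) * (sgn (k ℕ.∸ 1) * H (suc n ℕ.∸ k) * binom (suc n) k))
      ≡⟨ *-distribˡ-Σ₁ (suc n) (recip (suc n)) (λ k → sgn (k ℕ.∸ 1) * H (suc n ℕ.∸ k) * binom (suc n) k) ⟨
    recip (suc n) * Σ₁ (suc n) (λ k → sgn (k ℕ.∸ 1) * H (suc n ℕ.∸ k) * binom (suc n) k)
      ≡⟨ cong (recip (suc n) *_) (Σ₁-harmonic-tail-binomial n) ⟩
    increment n
      ∎

S₁ : ℕ → ℚ
S₁ n = Σ₁ n (λ k → sgn k * recip (k ℕ.* (n C k)))

S₁-closed : ∀ n → S₁ n ≡ sgn n * recip (suc n) - recip (suc n)
S₁-closed n = begin
  S₁ n                                              ≡⟨ Σ₁-cong n (λ j j<n → cong (sgn (suc j) *_) (split j j<n)) ⟩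
  Σ₁ n (λ k → sgn k * (z (ℕ.pred k) + z k))         ≡⟨ Σ₁-alternating-telescope n z ⟩
  sgn n * z n - z 0                                 ≡⟨ cong (λ c → sgn n * recip (suc n ℕ.* c) - z 0) (nCn≡1 n) ⟩
  sgn n * recip (suc n ℕ.* 1) - recip (suc n ℕ.* 1) ≡⟨ cong (λ m → sgn n * recip m - recip m) (ℕ.*-identityʳ (suc n)) ⟩
  sgn n * recip (suc n) - recip (suc n)             ∎
  where
  z : ℕ → ℚ
  z j = recip (suc n ℕ.* (n C j))
  split : ∀ j → j ℕ.< n → recip (suc j ℕ.* (n C suc j)) ≡ z j + z (suc j)
  split j j<n = sym (recip+recip≡recip x y (suc j ℕ.* c₁) cleared)
    where
    c₀ = n C j
    c₁ = n C suc j
    x = suc n ℕ.* c₀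
    y = suc n ℕ.* c₁
    instance
      c₀≢0 : NonZero c₀
      c₀≢0 = ℕ.>-nonZero (nCk>0 (ℕ.<⇒≤ j<n))
      c₁≢0 : NonZero c₁
      c₁≢0 = ℕ.>-nonZero (nCk>0 j<n)
      x≢0 : NonZero x
      x≢0 = ℕ.m*n≢0 (suc n) c₀
      y≢0 : NonZero y
      y≢0 = ℕ.m*n≢0 (suc n) c₁
      [j+1]c₁≢0 : NonZero (suc j ℕ.* c₁)
      [j+1]c₁≢0 = ℕ.m*n≢0 (suc j) c₁
    swap₁ : ∀ k b m c → k ℕ.* b ℕ.* (m ℕ.* c) ≡ b ℕ.* m ℕ.* (k ℕ.* c)
    swap₁ = solve-∀
    swap₂ : ∀ b m a → b ℕ.* m ℕ.* (m ℕ.* a) ≡ m ℕ.* a ℕ.* (m ℕ.* b)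
    swap₂ = solve-∀
    cleared : suc j ℕ.* c₁ ℕ.* (x ℕ.+ y) ≡ x ℕ.* y
    cleared = begin
      suc j ℕ.* c₁ ℕ.* (suc n ℕ.* c₀ ℕ.+ suc n ℕ.* c₁)
        ≡⟨ cong (suc j ℕ.* c₁ ℕ.*_) (trans (sym (ℕ.*-distribˡ-+ (suc n) c₀ c₁))
                                           (cong (suc n ℕ.*_) (nCk+nC[k+1]≡[n+1]C[k+1] n j))) ⟩
      suc j ℕ.* c₁ ℕ.* (suc n ℕ.* (suc n C suc j))
        ≡⟨ swap₁ (suc j) c₁ (suc n) (suc n C suc j) ⟩
      c₁ ℕ.* suc n ℕ.* (suc j ℕ.* (suc n C suc j))
        ≡⟨ cong (c₁ ℕ.* suc n ℕ.*_) ([k+1]*[n+1]C[k+1]≡[n+1]*nCk n j) ⟩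
      c₁ ℕ.* suc n ℕ.* (suc n ℕ.* c₀)
        ≡⟨ swap₂ c₁ (suc n) c₀ ⟩
      suc n ℕ.* c₀ ℕ.* (suc n ℕ.* c₁)
        ∎

S₂ : ℕ → ℚ
S₂ n = Σ₁ n (λ k → sgn k * recip (k ℕ.* k ℕ.* (n C k)))

S₂-suc : ∀ n → S₂ (suc n) ≡ S₂ n - recip (suc n) * S₁ n - sgn n * (recip (suc n) * recip (suc n))
S₂-suc n = begin
  S₂ (suc n)
    ≡⟨ cong₂ _+_ (Σ₁-cong n term) top ⟩
  Σ₁ n (λ k → sgn k * recip (k ℕ.* k ℕ.* (n C k)) - R * (sgn k * recip (k ℕ.* (n C k)))) + - sgn n * (R * R)
    ≡⟨ cong (_+ - sgn n * (R * R)) body ⟩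
  S₂ n - R * S₁ n + - sgn n * (R * R)
    ≡⟨ cong (_+_ (S₂ n - R * S₁ n)) (neg-distribˡ-* (sgn n) (R * R)) ⟨
  S₂ n - R * S₁ n - sgn n * (R * R)
    ∎
  where
  R = recip (suc n)
  top : - sgn n * recip (suc n ℕ.* suc n ℕ.* (suc n C suc n)) ≡ - sgn n * (R * R)
  top = cong (- sgn n *_) (begin
    recip (suc n ℕ.* suc n ℕ.* (suc n C suc n)) ≡⟨ cong (λ c → recip (suc n ℕ.* suc n ℕ.* c)) (nCn≡1 (suc n)) ⟩
    recip (suc n ℕ.* suc n ℕ.* 1)               ≡⟨ cong recip (ℕ.*-identityʳ (suc n ℕ.* suc n)) ⟩
    recip (suc n ℕ.* suc n)                     ≡⟨ recip-* (suc n) (suc n) ⟩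
    R * R                                       ∎)
  body : Σ₁ n (λ k → sgn k * recip (k ℕ.* k ℕ.* (n C k)) - R * (sgn k * recip (k ℕ.* (n C k))))
         ≡ S₂ n - R * S₁ n
  body = begin
    Σ₁ n (λ k → sgn k * recip (k ℕ.* k ℕ.* (n C k)) - R * (sgn k * recip (k ℕ.* (n C k))))
      ≡⟨ Σ₁-+ n (λ k → sgn k * recip (k ℕ.* k ℕ.* (n C k))) (λ k → - (R * (sgn k * recip (k ℕ.* (n C k))))) ⟩
    S₂ n + Σ₁ n (λ k → - (R * (sgn k * recip (k ℕ.* (n C k)))))
      ≡⟨ cong (_+_ (S₂ n)) (trans (cong -_ (*-distribˡ-Σ₁ n R (λ k → sgn k * recip (k ℕ.* (n C k)))))
                                  (neg-distrib-Σ₁ n (λ k → R * (sgn k * recip (k ℕ.* (n C k)))))) ⟨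
    S₂ n - R * S₁ n
      ∎
  factor : ∀ k d m c → k ℕ.* k ℕ.* d ℕ.+ m ℕ.* (k ℕ.* c) ≡ k ℕ.* (m ℕ.* c ℕ.+ k ℕ.* d)
  factor = solve-∀
  swap : ∀ k c m d → k ℕ.* k ℕ.* c ℕ.* (k ℕ.* (m ℕ.* d)) ≡ k ℕ.* k ℕ.* d ℕ.* (m ℕ.* (k ℕ.* c))
  swap = solve-∀
  cleared : ∀ k → let c = n C k; d = suc n C k in
            k ℕ.* k ℕ.* c ℕ.* (k ℕ.* k ℕ.* d ℕ.+ suc n ℕ.* (k ℕ.* c))
            ≡ k ℕ.* k ℕ.* d ℕ.* (suc n ℕ.* (k ℕ.* c))
  cleared k = begin
    k ℕ.* k ℕ.* c ℕ.* (k ℕ.* k ℕ.* d ℕ.+ suc n ℕ.* (k ℕ.* c))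
      ≡⟨ cong (k ℕ.* k ℕ.* c ℕ.*_) (factor k d (suc n) c) ⟩
    k ℕ.* k ℕ.* c ℕ.* (k ℕ.* (suc n ℕ.* c ℕ.+ k ℕ.* d))
      ≡⟨ cong (λ t → k ℕ.* k ℕ.* c ℕ.* (k ℕ.* t)) ([n+1]*nCk+k*[n+1]Ck≡[n+1]*[n+1]Ck n k) ⟩
    k ℕ.* k ℕ.* c ℕ.* (k ℕ.* (suc n ℕ.* d))
      ≡⟨ swap k c (suc n) d ⟩
    k ℕ.* k ℕ.* d ℕ.* (suc n ℕ.* (k ℕ.* c))
      ∎
    where
    c = n C k
    d = suc n C k
  term : ∀ j → j ℕ.< n →
         sgn (suc j) * recip (suc j ℕ.* suc j ℕ.* (suc n C suc j))
         ≡ sgn (suc j) * recip (suc j ℕ.* suc j ℕ.* (n C suc j)) - R * (sgn (suc j) * recip (suc j ℕ.* (n C suc j)))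
  term j j<n = begin
    sgn k * recip x
      ≡⟨ cong (sgn k *_) recip-x ⟩
    sgn k * (recip z - R * recip (k ℕ.* c))
      ≡⟨ solve 3 (λ s u v → s :* (u :- v) := s :* u :- v :* s) refl (sgn k) (recip z) (R * recip (k ℕ.* c)) ⟩
    sgn k * recip z - R * recip (k ℕ.* c) * sgn k
      ≡⟨ cong (_-_ (sgn k * recip z)) (xy∙z≈x∙zy R (recip (k ℕ.* c)) (sgn k)) ⟩
    sgn k * recip z - R * (sgn k * recip (k ℕ.* c))
      ∎
    where
    open +-*-Solver
    k = suc j
    c = n C k
    d = suc n C k
    x = k ℕ.* k ℕ.* d
    y = suc n ℕ.* (k ℕ.* c)
    z = k ℕ.* k ℕ.* c
    instance
      c≢0 : NonZero c
      c≢0 = ℕ.>-nonZero (nCk>0 j<n)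
      kc≢0 : NonZero (k ℕ.* c)
      kc≢0 = ℕ.m*n≢0 k c
      x≢0 : NonZero x
      x≢0 = ℕ.m*n≢0 (k ℕ.* k) d {{it}} {{ℕ.>-nonZero (nCk>0 (ℕ.m≤n⇒m≤1+n j<n))}}
      y≢0 : NonZero y
      y≢0 = ℕ.m*n≢0 (suc n) (k ℕ.* c)
      z≢0 : NonZero z
      z≢0 = ℕ.m*n≢0 (k ℕ.* k) c
    recip-x : recip x ≡ recip z - R * recip (k ℕ.* c)
    recip-x = begin
      recip x                     ≡⟨ solve 2 (λ u v → u := u :+ v :- v) refl (recip x) (recip y) ⟩
      recip x + recip y - recip y ≡⟨ cong₂ _-_ (recip+recip≡recip x y z (cleared k)) (recip-* (suc n) (k ℕ.* c)) ⟩
      recip z - R * recip (k ℕ.* c) ∎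

rhs-suc : ∀ n → rhs (suc n) ≡ rhs n + increment n + increment n
rhs-suc n = begin
  H (suc n) * H (suc n) + S₂ (suc n)
    ≡⟨ cong (_+_ (H (suc n) * H (suc n))) (S₂-suc n) ⟩
  H (suc n) * H (suc n) + (S₂ n - r * S₁ n - sgn n * (r * r))
    ≡⟨ cong (λ t → H (suc n) * H (suc n) + (S₂ n - r * t - sgn n * (r * r))) (S₁-closed n) ⟩
  (H n + r) * (H n + r) + (S₂ n - r * (sgn n * r - r) - sgn n * (r * r))
    ≡⟨ solve 4 (λ h b r s → (h :+ r) :* (h :+ r) :+ (b :- r :* (s :* r :- r) :- s :* (r :* r))
                            := h :* h :+ b :+ r :* (h :+ r :- s :* r) :+ r :* (h :+ r :- s :* r))
               refl (H n) (S₂ n) r (sgn n) ⟩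
  rhs n + increment n + increment n
    ∎
  where
  open +-*-Solver
  r = recip (suc n)

mainTheorem1 : (n : ℕ) → lhs n ≡ rhs n
mainTheorem1 zero    = refl
mainTheorem1 (suc n) = begin
  lhs (suc n)                       ≡⟨ lhs-suc n ⟩
  lhs n + increment n + increment n ≡⟨ cong (λ t → t + increment n + increment n) (mainTheorem1 n) ⟩
  rhs n + increment n + increment n ≡⟨ rhs-suc n ⟨
  rhs (suc n)                       ∎
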